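{- Let $n_1, n_2, n_3$ be three pairwise coprime positive integers which are the minimal generators of the numerical semigroup $\langle n_1,n_2,n_3\rangle$, let $\{i,j,k\}=\{1,2,3\}$, and let $c_k$ be the smallest positive integer $M$ such that $M n_k \in \langle n_i, n_j\rangle$. If $$n_j \ge [-n_i n_k^{ -1}]_{n_j}\left( \left\lfloor \frac{n_k}{[n_i n_j^{ -1}]_{n_k}} \right\rfloor + 1 \right),$$ then $$c_k = n_j - [-n_i n_k^{ -1}]_{n_j} \left\lfloor \frac{n_k}{[n_i n_j^{ -1}]_{n_k}} \right\rfloor.$$
   Context: $\langle a_1,\dots,a_r\rangle$ denotes the set of linear combinations of $a_1,\dots,a_r$ with nonnegative integer coefficients; "minimal generators" means none of $n_1,n_2,n_3$ is such a combination of the other two. For integers $m$ and $n>0$, $[m]_n$ denotes the remainder of the Euclidean division of $m$ by $n$ (so $0\le[m]_n<n$); for $b$ coprime to $n$, $[a b^{ -1}]_n$ denotes the remainder modulo $n$ of $a$ times a multiplicative inverse of $b$ modulo $n$. -}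

module Defs where

open import Data.Nat using (ℕ; zero; suc; _+_; _*_; _<_; _≤_)
import Data.Nat.DivMod as ℕD
open import Data.Integer using (ℤ; +_)
import Data.Integer.DivMod as ℤD
open import Data.Product using (Σ; _×_; ∃-syntax)
open import Relation.Binary.PropositionalEquality using (_≡_)
open import Relation.Nullary using (¬_)

infix 4 _∈⟨_,_⟩
_∈⟨_,_⟩ : ℕ → ℕ → ℕ → Set
m ∈⟨ a , b ⟩ = ∃[ x ] ∃[ y ] x * a + y * b ≡ m

MinimalGenerators : ℕ → ℕ → ℕ → Set
MinimalGenerators n₁ n₂ n₃ =
  ¬ (n₁ ∈⟨ n₂ , n₃ ⟩) × ¬ (n₂ ∈⟨ n₁ , n₃ ⟩) × ¬ (n₃ ∈⟨ n₁ , n₂ ⟩)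

-- [m]_n for an integer m and n > 0 (remainder of Euclidean division);
-- the value for n = 0 is an irrelevant convention (never used).
infix 10 [_]_
[_]_ : ℤ → ℕ → ℕ
[ m ] zero = 0
[ m ] (suc n) = m ℤD.%ℕ suc n

-- ⌊m / n⌋ for n > 0; value 0 for n = 0 is an irrelevant convention.
⌊_/_⌋ : ℕ → ℕ → ℕ
⌊ m / zero ⌋ = 0
⌊ m / suc n ⌋ = m ℕD./ suc n

IsInverseMod : ℕ → ℕ → ℕ → Set
IsInverseMod u b n = [ + (u * b) ] n ≡ [ + 1 ] n

IsCk : ℕ → ℕ → ℕ → ℕ → Set
IsCk nᵢ nⱼ nₖ c =
  (0 < c) × (c * nₖ ∈⟨ nᵢ , nⱼ ⟩) ×
  (∀ M → 0 < M → M * nₖ ∈⟨ nᵢ , nⱼ ⟩ → c ≤ M)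

{-# OPTIONS --safe #-}
-- Put a = [-nᵢ nₖ⁻¹]_nⱼ and r = [nᵢ nⱼ⁻¹]_nₖ. Then nᵢ + a nₖ = r nⱼ, where the cofactor
-- (a nₖ + nᵢ)/nⱼ is below nₖ because nᵢ is not in ⟨nⱼ, nₖ⟩, and so equals r.
-- With q = ⌊nₖ/r⌋ this relation gives (nⱼ − a q) nₖ = q nᵢ + (nₖ − q r) nⱼ, hence
-- c ≤ nⱼ − a q. Conversely, if M nₖ = x nᵢ + y nⱼ with M > 0, eliminating nᵢ shows
-- M + x a = m nⱼ with m ≥ 1 and m nₖ = x r + y, so x < m (q + 1); together with
-- a (q + 1) ≤ nⱼ this forces M ≥ nⱼ − a q.
module Submission where

open import Defs
open import Data.Nat
open import Data.Nat.Properties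
open import Data.Nat.DivMod
open import Data.Nat.Divisibility
  using (_∣_; divides; quotient; ∣m+n∣m⇒∣n; ∣m∣n⇒∣m+n; ∣m⇒∣m*n; n∣m*n)
open import Data.Nat.Coprimality using (Coprime; coprime-divisor)
open import Data.Nat.Tactic.RingSolver using (solve)
open import Data.Integer as ℤ using (ℤ; +_; -_)
import Data.Integer.Properties as ℤ
import Data.Integer.DivMod as ℤ
import Data.Integer.Tactic.RingSolver as ℤ-Solver
open import Data.List using (_∷_; [])
open import Data.Product using (∃-syntax; _×_; _,_)
open import Data.Empty using (⊥-elim)
open import Relation.Binary.PropositionalEquality hiding ([_])
open import Relation.Nullary using (¬_; yes; no)

a*q<n : ∀ a q {n} → 0 < n → a * suc q ≤ n → a * q < n
a*q<n zero    _ 0<n _ = 0<n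
a*q<n (suc a) q _ a[1+q]≤n = <-≤-trans (*-monoʳ-< (suc a) (n<1+n q)) a[1+q]≤n

cofactor-bound : ∀ x r y m nₖ q .{{_ : NonZero m}} → m * nₖ ≡ x * r + y →
  nₖ < suc q * r → x < m * suc q
cofactor-bound x r y m nₖ q m*nₖ≡ nₖ<[1+q]r =
  *-cancelʳ-< r x (m * suc q) (begin-strict
    x * r            ≤⟨ m≤m+n (x * r) y ⟩
    x * r + y        ≡⟨ sym m*nₖ≡ ⟩
    m * nₖ           <⟨ *-monoʳ-< m nₖ<[1+q]r ⟩
    m * (suc q * r)  ≡⟨ sym (*-assoc m (suc q) r) ⟩
    m * suc q * r    ∎)
  where open ≤-Reasoning

≤-from-cofactor-bound : ∀ M x a m q n → M + x * a ≡ suc m * n →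
  x < suc m * suc q → a * suc q ≤ n → n ≤ M + a * q
≤-from-cofactor-bound M x a m q n M+xa≡ x<[1+m][1+q] a[1+q]≤n =
  +-cancelʳ-≤ (m * n) n (M + a * q) (begin
    n + m * n                      ≡⟨ sym M+xa≡ ⟩
    M + x * a                      ≤⟨ +-monoʳ-≤ M (*-monoˡ-≤ a x≤) ⟩
    M + (m * suc q + q) * a        ≡⟨ solve (M ∷ m ∷ q ∷ a ∷ []) ⟩
    M + a * q + m * (a * suc q)    ≤⟨ +-monoʳ-≤ (M + a * q) (*-monoʳ-≤ m a[1+q]≤n) ⟩
    M + a * q + m * n              ∎)
  where
  open ≤-Reasoning
  x≤ : x ≤ m * suc q + q
  x≤ = ≤-pred (subst (x <_) (cong suc (+-comm q (m * suc q))) x<[1+m][1+q])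

module _ (nᵢ nⱼ nₖ a r : ℕ) (rel : nᵢ + a * nₖ ≡ r * nⱼ) where

  relation⇒[nⱼ∸aq]*nₖ∈ : ∀ q → a * q ≤ nⱼ → q * r ≤ nₖ → (nⱼ ∸ a * q) * nₖ ∈⟨ nᵢ , nⱼ ⟩
  relation⇒[nⱼ∸aq]*nₖ∈ q aq≤nⱼ qr≤nₖ =
    q , nₖ ∸ q * r , decomposition _ _ (m∸n+n≡m aq≤nⱼ) (m∸n+n≡m qr≤nₖ)
    where
    open ≡-Reasoning
    decomposition : ∀ g e → g + a * q ≡ nⱼ → e + q * r ≡ nₖ → q * nᵢ + e * nⱼ ≡ g * nₖ
    decomposition g e g+aq≡nⱼ e+qr≡nₖ = +-cancelʳ-≡ (a * q * nₖ) _ _ (begin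
      q * nᵢ + e * nⱼ + a * q * nₖ   ≡⟨ solve (q ∷ nᵢ ∷ e ∷ nⱼ ∷ a ∷ nₖ ∷ []) ⟩
      q * (nᵢ + a * nₖ) + e * nⱼ     ≡⟨ cong (λ t → q * t + e * nⱼ) rel ⟩
      q * (r * nⱼ) + e * nⱼ          ≡⟨ solve (q ∷ r ∷ nⱼ ∷ e ∷ []) ⟩
      (e + q * r) * nⱼ               ≡⟨ cong (_* nⱼ) e+qr≡nₖ ⟩
      nₖ * nⱼ                        ≡⟨ cong (nₖ *_) (sym g+aq≡nⱼ) ⟩
      nₖ * (g + a * q)               ≡⟨ solve (nₖ ∷ g ∷ a ∷ q ∷ []) ⟩
      g * nₖ + a * q * nₖ            ∎)

  eliminate-nᵢ : ∀ M x y .{{_ : NonZero nⱼ}} → Coprime nⱼ nₖ →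
    x * nᵢ + y * nⱼ ≡ M * nₖ → ∃[ m ] M + x * a ≡ m * nⱼ × m * nₖ ≡ x * r + y
  eliminate-nᵢ M x y nⱼ⊥nₖ comb =
    m , M+xa≡ , *-cancelʳ-≡ (m * nₖ) (x * r + y) nⱼ (begin
      m * nₖ * nⱼ       ≡⟨ trans (cong (_* nⱼ) (*-comm m nₖ)) (*-assoc nₖ m nⱼ) ⟩
      nₖ * (m * nⱼ)     ≡⟨ cong (nₖ *_) (sym M+xa≡) ⟩
      nₖ * (M + x * a)  ≡⟨ nₖ*[M+xa]≡ ⟩
      (x * r + y) * nⱼ  ∎)
    where
    open ≡-Reasoning
    nₖ*[M+xa]≡ : nₖ * (M + x * a) ≡ (x * r + y) * nⱼ
    nₖ*[M+xa]≡ = begin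
      nₖ * (M + x * a)                ≡⟨ solve (nₖ ∷ M ∷ x ∷ a ∷ []) ⟩
      M * nₖ + x * (a * nₖ)           ≡⟨ cong (_+ x * (a * nₖ)) (sym comb) ⟩
      x * nᵢ + y * nⱼ + x * (a * nₖ)  ≡⟨ solve (x ∷ nᵢ ∷ y ∷ nⱼ ∷ a ∷ nₖ ∷ []) ⟩
      x * (nᵢ + a * nₖ) + y * nⱼ      ≡⟨ cong (λ t → x * t + y * nⱼ) rel ⟩
      x * (r * nⱼ) + y * nⱼ           ≡⟨ solve (x ∷ r ∷ nⱼ ∷ y ∷ []) ⟩
      (x * r + y) * nⱼ                ∎
    nⱼ∣M+xa : nⱼ ∣ M + x * a
    nⱼ∣M+xa = coprime-divisor nⱼ⊥nₖ (divides (x * r + y) nₖ*[M+xa]≡)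
    m : ℕ
    m = quotient nⱼ∣M+xa
    M+xa≡ : M + x * a ≡ m * nⱼ
    M+xa≡ = _∣_.equality nⱼ∣M+xa

  relation⇒nⱼ≤M+aq : ∀ q M .{{_ : NonZero nⱼ}} → Coprime nⱼ nₖ →
    nₖ < suc q * r → a * suc q ≤ nⱼ → 0 < M → M * nₖ ∈⟨ nᵢ , nⱼ ⟩ → nⱼ ≤ M + a * q
  relation⇒nⱼ≤M+aq q M nⱼ⊥nₖ nₖ<[1+q]r a[1+q]≤nⱼ 0<M (x , y , comb)
    with eliminate-nᵢ M x y nⱼ⊥nₖ comb
  ... | zero  , M+xa≡0 , _ = ⊥-elim (<⇒≢ (≤-trans 0<M (m≤m+n M (x * a))) (sym M+xa≡0))
  ... | suc m , M+xa≡ , [1+m]nₖ≡ = ≤-from-cofactor-bound M x a m q nⱼ M+xa≡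
    (cofactor-bound x r y (suc m) nₖ q [1+m]nₖ≡ nₖ<[1+q]r) a[1+q]≤nⱼ

  IsCk⇒≡nⱼ∸aq : ∀ q c .{{_ : NonZero nⱼ}} → Coprime nⱼ nₖ →
    q * r ≤ nₖ → nₖ < suc q * r → a * suc q ≤ nⱼ → IsCk nᵢ nⱼ nₖ c → c ≡ nⱼ ∸ a * q
  IsCk⇒≡nⱼ∸aq q c nⱼ⊥nₖ qr≤nₖ nₖ<[1+q]r a[1+q]≤nⱼ (0<c , cnₖ∈ , minimal) =
    ≤-antisym c≤ ≥c
    where
    aq<nⱼ : a * q < nⱼ
    aq<nⱼ = a*q<n a q (>-nonZero⁻¹ nⱼ) a[1+q]≤nⱼ
    c≤ : c ≤ nⱼ ∸ a * q
    c≤ = minimal (nⱼ ∸ a * q) (m<n⇒0<n∸m aq<nⱼ)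
           (relation⇒[nⱼ∸aq]*nₖ∈ q (<⇒≤ aq<nⱼ) qr≤nₖ)
    ≥c : nⱼ ∸ a * q ≤ c
    ≥c = subst (nⱼ ∸ a * q ≤_) (m+n∸n≡m c (a * q))
           (∸-monoˡ-≤ (a * q) (relation⇒nⱼ≤M+aq q c nⱼ⊥nₖ nₖ<[1+q]r a[1+q]≤nⱼ 0<c cnₖ∈))

m%n≡k%n⇒m+[k/n]*n≡k+[m/n]*n : ∀ m k n .{{_ : NonZero n}} → m % n ≡ k % n →
  m + (k / n) * n ≡ k + (m / n) * n
m%n≡k%n⇒m+[k/n]*n≡k+[m/n]*n m k n m%n≡k%n = begin
  m + (k / n) * n                    ≡⟨ cong (_+ (k / n) * n) (m≡m%n+[m/n]*n m n) ⟩
  m % n + (m / n) * n + (k / n) * n  ≡⟨ cong (λ t → t + (m / n) * n + (k / n) * n) m%n≡k%n ⟩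
  k % n + (m / n) * n + (k / n) * n  ≡⟨ swap (k % n) ((m / n) * n) ((k / n) * n) ⟩
  k % n + (k / n) * n + (m / n) * n  ≡⟨ cong (_+ (m / n) * n) (sym (m≡m%n+[m/n]*n k n)) ⟩
  k + (m / n) * n                    ∎
  where
  open ≡-Reasoning
  swap : ∀ r s t → r + s + t ≡ r + t + s
  swap r s t = solve (r ∷ s ∷ t ∷ [])

∣-times-inverse : ∀ {n} a x u k α β → n ∣ a + x * u → u * k + α * n ≡ 1 + β * n →
  n ∣ a * k + x
∣-times-inverse {n} a x u k α β n∣a+xu uk≡1 = ∣m+n∣m⇒∣n
  (subst (n ∣_) expand (∣m∣n⇒∣m+n (n∣m*n (x * α)) (∣m⇒∣m*n k n∣a+xu)))
  (n∣m*n (x * β))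
  where
  open ≡-Reasoning
  expand : x * α * n + (a + x * u) * k ≡ x * β * n + (a * k + x)
  expand = begin
    x * α * n + (a + x * u) * k  ≡⟨ solve (x ∷ α ∷ n ∷ a ∷ u ∷ k ∷ []) ⟩
    a * k + x * (u * k + α * n)  ≡⟨ cong (λ t → a * k + x * t) uk≡1 ⟩
    a * k + x * (1 + β * n)      ≡⟨ solve (a ∷ k ∷ x ∷ β ∷ n ∷ []) ⟩
    x * β * n + (a * k + x)      ∎

∣[-x*u]%ℕd+x*u : ∀ x u d .{{_ : NonZero d}} → d ∣ (- (+ x) ℤ.* + u) ℤ.%ℕ d + x * u
∣[-x*u]%ℕd+x*u x u d = divides ℤ.∣ Q ∣ (begin
  R + x * u                ≡⟨ cong ℤ.∣_∣ (ℤ.pos-+ R (x * u)) ⟩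
  ℤ.∣ + R ℤ.+ + (x * u) ∣  ≡⟨ cong ℤ.∣_∣ (isolate (+ R) (+ (x * u)) (Q ℤ.* + d) -xu≡R+Qd) ⟩
  ℤ.∣ - (Q ℤ.* + d) ∣      ≡⟨ ℤ.∣-i∣≡∣i∣ (Q ℤ.* + d) ⟩
  ℤ.∣ Q ℤ.* + d ∣          ≡⟨ ℤ.abs-* Q (+ d) ⟩
  ℤ.∣ Q ∣ * d              ∎)
  where
  open ≡-Reasoning
  A Q : ℤ
  A = - (+ x) ℤ.* + u
  Q = A ℤ./ℕ d
  R : ℕ
  R = A ℤ.%ℕ d
  -xu≡R+Qd : - + (x * u) ≡ + R ℤ.+ Q ℤ.* + d
  -xu≡R+Qd = trans (trans (cong -_ (ℤ.pos-* x u)) (ℤ.neg-distribˡ-* (+ x) (+ u)))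
                   (ℤ.a≡a%ℕn+[a/ℕn]*n A d)
  isolate : ∀ i j k → - j ≡ i ℤ.+ k → i ℤ.+ j ≡ - k
  isolate i j k -j≡i+k = begin
    i ℤ.+ j                    ≡⟨ ℤ-Solver.solve (i ∷ j ∷ k ∷ []) ⟩
    (i ℤ.+ k) ℤ.- k ℤ.- (- j)  ≡⟨ cong (λ t → t ℤ.- k ℤ.- (- j)) (sym -j≡i+k) ⟩
    - j ℤ.- k ℤ.- (- j)        ≡⟨ ℤ-Solver.solve (j ∷ k ∷ []) ⟩
    - k                        ∎

cofactor<nₖ : ∀ nᵢ nⱼ nₖ a b → ¬ (nᵢ ∈⟨ nⱼ , nₖ ⟩) → a < nⱼ →
  a * nₖ + nᵢ ≡ b * nⱼ → b < nₖ
cofactor<nₖ nᵢ nⱼ nₖ a b nᵢ∉⟨nⱼ,nₖ⟩ a<nⱼ rel with nₖ ≤? b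
... | no nₖ≰b = ≰⇒> nₖ≰b
... | yes nₖ≤b = ⊥-elim (nᵢ∉⟨nⱼ,nₖ⟩
      (b ∸ nₖ , nⱼ ∸ a , nᵢ-decomposition _ _ (m∸n+n≡m nₖ≤b) (m∸n+n≡m (<⇒≤ a<nⱼ))))
  where
  open ≡-Reasoning
  nᵢ-decomposition : ∀ d e → d + nₖ ≡ b → e + a ≡ nⱼ → d * nⱼ + e * nₖ ≡ nᵢ
  nᵢ-decomposition d e d+nₖ≡b e+a≡nⱼ = +-cancelʳ-≡ (a * nₖ) _ _ (begin
    d * nⱼ + e * nₖ + a * nₖ  ≡⟨ solve (d ∷ nⱼ ∷ e ∷ nₖ ∷ a ∷ []) ⟩
    d * nⱼ + (e + a) * nₖ     ≡⟨ cong (λ t → d * nⱼ + t * nₖ) e+a≡nⱼ ⟩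
    d * nⱼ + nⱼ * nₖ          ≡⟨ solve (d ∷ nⱼ ∷ nₖ ∷ []) ⟩
    (d + nₖ) * nⱼ             ≡⟨ cong (_* nⱼ) d+nₖ≡b ⟩
    b * nⱼ                    ≡⟨ sym rel ⟩
    a * nₖ + nᵢ               ≡⟨ +-comm (a * nₖ) nᵢ ⟩
    nᵢ + a * nₖ               ∎)

[x*v]%k≡cofactor : ∀ x n k a b v α β .{{_ : NonZero k}} → v * n + α * k ≡ 1 + β * k →
  a * k + x ≡ b * n → b < k → (x * v) % k ≡ b
[x*v]%k≡cofactor x n k a b v α β vn≡1 rel b<k = begin
  (x * v) % k                          ≡⟨ cong (_% k) (*-comm x v) ⟩
  (v * x) % k                          ≡⟨ sym ([m+kn]%n≡m%n (v * x) (v * a + b * α) k) ⟩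
  (v * x + (v * a + b * α) * k) % k    ≡⟨ cong (_% k) expand ⟩
  (b + (b * β) * k) % k                ≡⟨ [m+kn]%n≡m%n b (b * β) k ⟩
  b % k                                ≡⟨ m<n⇒m%n≡m b<k ⟩
  b                                    ∎
  where
  open ≡-Reasoning
  expand : v * x + (v * a + b * α) * k ≡ b + (b * β) * k
  expand = begin
    v * x + (v * a + b * α) * k  ≡⟨ solve (v ∷ x ∷ a ∷ b ∷ α ∷ k ∷ []) ⟩
    v * (a * k + x) + b * α * k  ≡⟨ cong (λ t → v * t + b * α * k) rel ⟩
    v * (b * n) + b * α * k      ≡⟨ solve (v ∷ b ∷ n ∷ α ∷ k ∷ []) ⟩
    b * (v * n + α * k)          ≡⟨ cong (b *_) vn≡1 ⟩
    b * (1 + β * k)              ≡⟨ solve (b ∷ β ∷ k ∷ []) ⟩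
    b + (b * β) * k              ∎

cofactor>0 : ∀ {x y n} b → 0 < x → y + x ≡ b * n → 0 < b
cofactor>0 {x} {y} zero    0<x y+x≡0 = ⊥-elim (<⇒≢ (≤-trans 0<x (m≤n+m x y)) (sym y+x≡0))
cofactor>0         (suc b) _   _     = z<s

⌊m/n⌋*n≤m : ∀ m n → 0 < n → ⌊ m / n ⌋ * n ≤ m
⌊m/n⌋*n≤m m (suc n) _ = m/n*n≤m m (suc n)

m<[1+⌊m/n⌋]*n : ∀ m n → 0 < n → m < suc ⌊ m / n ⌋ * n
m<[1+⌊m/n⌋]*n m (suc n) _ = begin-strict
  m                               ≡⟨ m≡m%n+[m/n]*n m (suc n) ⟩
  m % suc n + (m / suc n) * suc n <⟨ +-monoˡ-< _ (m%n<n m (suc n)) ⟩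
  suc n + (m / suc n) * suc n     ∎
  where open ≤-Reasoning

residues⇒relation : ∀ nᵢ nⱼ nₖ u v → 0 < nᵢ → ¬ (nᵢ ∈⟨ nⱼ , nₖ ⟩) →
  0 < nⱼ → 0 < nₖ → IsInverseMod u nₖ nⱼ → IsInverseMod v nⱼ nₖ →
  let a = [ - (+ nᵢ) ℤ.* (+ u) ] nⱼ; r = [ + nᵢ ℤ.* (+ v) ] nₖ in
  nᵢ + a * nₖ ≡ r * nⱼ × 0 < r
residues⇒relation nᵢ nⱼ@(suc _) nₖ@(suc _) u v 0<nᵢ nᵢ∉⟨nⱼ,nₖ⟩ _ _ u⁻¹ v⁻¹ =
  trans (+-comm nᵢ (a * nₖ)) (trans ank+nᵢ≡bnⱼ (cong (_* nⱼ) (sym r≡b))) ,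
  subst (0 <_) (sym r≡b) (cofactor>0 b 0<nᵢ ank+nᵢ≡bnⱼ)
  where
  a b : ℕ
  a = [ - (+ nᵢ) ℤ.* (+ u) ] nⱼ
  nⱼ∣ank+nᵢ : nⱼ ∣ a * nₖ + nᵢ
  nⱼ∣ank+nᵢ = ∣-times-inverse a nᵢ u nₖ (1 / nⱼ) ((u * nₖ) / nⱼ)
    (∣[-x*u]%ℕd+x*u nᵢ u nⱼ) (m%n≡k%n⇒m+[k/n]*n≡k+[m/n]*n (u * nₖ) 1 nⱼ u⁻¹)
  b = quotient nⱼ∣ank+nᵢ
  ank+nᵢ≡bnⱼ : a * nₖ + nᵢ ≡ b * nⱼ
  ank+nᵢ≡bnⱼ = _∣_.equality nⱼ∣ank+nᵢ
  r≡b : [ + nᵢ ℤ.* (+ v) ] nₖ ≡ b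
  r≡b = trans (cong (ℤ._%ℕ nₖ) (sym (ℤ.pos-* nᵢ v)))
    ([x*v]%k≡cofactor nᵢ nⱼ nₖ a b v (1 / nₖ) ((v * nⱼ) / nₖ)
      (m%n≡k%n⇒m+[k/n]*n≡k+[m/n]*n (v * nⱼ) 1 nₖ v⁻¹) ank+nᵢ≡bnⱼ
      (cofactor<nₖ nᵢ nⱼ nₖ a b nᵢ∉⟨nⱼ,nₖ⟩ (ℤ.n%ℕd<d (- (+ nᵢ) ℤ.* + u) nⱼ) ank+nᵢ≡bnⱼ))

corollary3p1 :
    (nᵢ nⱼ nₖ : ℕ) → 0 < nᵢ → 0 < nⱼ → 0 < nₖ →
    Coprime nᵢ nⱼ → Coprime nᵢ nₖ → Coprime nⱼ nₖ →
    MinimalGenerators nᵢ nⱼ nₖ →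
    (u : ℕ) → IsInverseMod u nₖ nⱼ →
    (v : ℕ) → IsInverseMod v nⱼ nₖ →
    (c : ℕ) → IsCk nᵢ nⱼ nₖ c →
    [ - (+ nᵢ) ℤ.* (+ u) ] nⱼ * (⌊ nₖ / [ + nᵢ ℤ.* (+ v) ] nₖ ⌋ + 1) ≤ nⱼ →
    c ≡ nⱼ ∸ [ - (+ nᵢ) ℤ.* (+ u) ] nⱼ * ⌊ nₖ / [ + nᵢ ℤ.* (+ v) ] nₖ ⌋
corollary3p1 nᵢ nⱼ nₖ 0<nᵢ 0<nⱼ 0<nₖ _ _ nⱼ⊥nₖ (nᵢ∉⟨nⱼ,nₖ⟩ , _ , _) u u⁻¹ v v⁻¹ c isCk a[q+1]≤nⱼ
  with residues⇒relation nᵢ nⱼ nₖ u v 0<nᵢ nᵢ∉⟨nⱼ,nₖ⟩ 0<nⱼ 0<nₖ u⁻¹ v⁻¹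
... | relation , 0<r =
  IsCk⇒≡nⱼ∸aq nᵢ nⱼ nₖ a r relation q c {{>-nonZero 0<nⱼ}} nⱼ⊥nₖ
    (⌊m/n⌋*n≤m nₖ r 0<r) (m<[1+⌊m/n⌋]*n nₖ r 0<r)
    (subst (λ t → a * t ≤ nⱼ) (+-comm q 1) a[q+1]≤nⱼ) isCk
  where
  a r q : ℕ
  a = [ - (+ nᵢ) ℤ.* (+ u) ] nⱼ
  r = [ + nᵢ ℤ.* (+ v) ] nₖ
  q = ⌊ nₖ / r ⌋
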